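{- Let $T$ be a rooted tree on vertex set $[n]$ and let $p\in[n]^n$ be such that $(T,p)$ is a prime parking function. Then the final driver (driver $n$) parks at the root of $T$.
   Context: Edges of $T$ are oriented towards the root. Drivers $1,\dots,n$ arrive in order; driver $i$ goes to $p_i$ and parks there if unoccupied; otherwise she travels along the directed path towards the root and parks at the first unoccupied vertex; if none, she leaves. $(T,p)$ is a parking function if all drivers park. For $v\in[n]$, $T_v$ is the subtree induced by vertices having a directed path (possibly of length $0$) to $v$; a parking function is prime if $|T_v|<|\{i:p_i\in V(T_v)\}|$ for every non-root vertex $v$. -}

module Defs where

open import Data.Nat using (ℕ; zero; suc; _+_; _<_)
open import Data.Fin using (Fin; zero; suc; _≟_)
open import Data.Bool using (Bool; true; false; if_then_else_; _∨_)
open import Data.Maybe using (Maybe; just; nothing)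
open import Data.Vec using (Vec; []; _∷_; tabulate; lookup)
open import Data.Product using (Σ; ∃; _×_)
open import Function using (_∘_)
open import Relation.Nullary using (¬_)
open import Relation.Nullary.Decidable using (⌊_⌋)
open import Relation.Binary.PropositionalEquality using (_≡_)

iter : ∀ {A : Set} → (A → A) → ℕ → A → A
iter f zero    x = x
iter f (suc k) x = f (iter f k x)

-- A rooted tree on vertex set Fin n, with edges oriented towards the root,
-- given by the parent map.  The root is its own "parent" (it has no
-- outgoing edge); every vertex reaches the root by following parents.
-- These two conditions characterise rooted trees on Fin n.
record RootedTree (n : ℕ) : Set where
  field
    root     : Fin n
    par      : Fin n → Fin n
    par-root : par root ≡ root
    reaches  : ∀ v → ∃ λ k → iter par k v ≡ root
open RootedTree public

-- Is there a directed path (possibly of length 0) from u to v?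
-- In a tree on n vertices such a path has fewer than n edges, so it
-- suffices to look at u, par u, ..., par^(n-1) u.
pathTo : ∀ {n} → RootedTree n → ℕ → Fin n → Fin n → Bool
pathTo T zero    u v = false
pathTo T (suc k) u v = ⌊ u ≟ v ⌋ ∨ pathTo T k (par T u) v

inSubtree : ∀ {n} → RootedTree n → Fin n → Fin n → Bool
inSubtree {n} T u v = pathTo T n u v

count : ∀ {n} → (Fin n → Bool) → ℕ
count {zero}  f = 0
count {suc n} f = (if f zero then 1 else 0) + count (f ∘ suc)

-- A driver arriving at v with occupancy `occ` walks towards the root and
-- takes the first unoccupied vertex (fuel n suffices: the walk from v to
-- the root visits at most n vertices; afterwards it stays at the root).
seek : ∀ {n} → RootedTree n → (Fin n → Bool) → ℕ → Fin n → Maybe (Fin n)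
seek T occ zero    v = nothing
seek T occ (suc k) v = if occ v then seek T occ k (par T v) else just v

occupy : ∀ {n} → (Fin n → Bool) → Fin n → (Fin n → Bool)
occupy occ v w = if ⌊ w ≟ v ⌋ then true else occ w

-- Run the drivers in order; result: spot where each driver parked
-- (nothing = she left).
run : ∀ {n m} → RootedTree n → (Fin n → Bool) → Vec (Fin n) m → Vec (Maybe (Fin n)) m
run T occ [] = []
run {n} T occ (x ∷ xs) with seek T occ n x
... | nothing = nothing ∷ run T occ xs
... | just v  = just v ∷ run T (occupy occ v) xs

outcome : ∀ {n} → RootedTree n → (Fin n → Fin n) → Vec (Maybe (Fin n)) n
outcome T p = run T (λ _ → false) (tabulate p)

IsParkingFunction : ∀ {n} → RootedTree n → (Fin n → Fin n) → Set
IsParkingFunction T p = ∀ i → Σ _ λ v → lookup (outcome T p) i ≡ just v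

IsPrimeParkingFunction : ∀ {n} → RootedTree n → (Fin n → Fin n) → Set
IsPrimeParkingFunction T p =
  IsParkingFunction T p ×
  (∀ v → ¬ (v ≡ root T) →
     count (λ u → inSubtree T u v) < count (λ i → inSubtree T (p i) v))

module Submission where

open import Defs
open import Data.Nat using (ℕ; zero; suc; _+_; _≤_; _<_; z≤n; s≤s)
open import Data.Nat.Properties
  using (≤-refl; +-assoc; +-comm; +-identityʳ; +-mono-≤; +-mono-≤-<; +-monoʳ-≤; m≤m+n; <⇒≱; module ≤-Reasoning)
open import Data.Fin using (Fin; fromℕ; zero; suc; _≟_)
open import Data.Bool using (Bool; true; false; _∧_; if_then_else_)
open import Data.Bool.Properties using (∧-zeroʳ)
open import Data.Maybe using (just; nothing)
open import Data.Vec using (Vec; []; _∷_; lookup; tabulate)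
open import Data.Product using (∃; _×_; _,_; proj₂)
open import Relation.Nullary using (yes; no; contradiction)
open import Relation.Binary.PropositionalEquality using (_≡_; refl; sym; trans; cong)

-- If the last driver parks at w ≠ root, then w was free throughout, so every
-- driver preferring a vertex of T_w found a free spot on her way to w, i.e.
-- inside T_w.  Distinct drivers take distinct spots, so at most |T_w| drivers
-- prefer T_w, contradicting primality.

_⊆ᵇ_ : ∀ {n} → (Fin n → Bool) → (Fin n → Bool) → Set
f ⊆ᵇ g = ∀ u → f u ≡ true → g u ≡ true

⊆ᵇ⇒false : ∀ {n} {f g : Fin n → Bool} → f ⊆ᵇ g → ∀ {u} → g u ≡ false → f u ≡ false
⊆ᵇ⇒false {f = f} f⊆g {u} gu≡false with f u in fu
... | false = refl
... | true  with () ← trans (sym (f⊆g u fu)) gu≡false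

∧-⊆ᵇˡ : ∀ {n} (s f : Fin n → Bool) → (λ u → s u ∧ f u) ⊆ᵇ s
∧-⊆ᵇˡ s f u su∧fu with s u
... | true = refl

∧-⊆ᵇʳ-mono : ∀ {n} (s : Fin n → Bool) {f g : Fin n → Bool} → f ⊆ᵇ g →
             (λ u → s u ∧ f u) ⊆ᵇ (λ u → s u ∧ g u)
∧-⊆ᵇʳ-mono s f⊆g u su∧fu with s u
... | true = f⊆g u su∧fu

bit-mono : ∀ {a b : Bool} → (a ≡ true → b ≡ true) → (if a then 1 else 0) ≤ (if b then 1 else 0)
bit-mono {false} a⇒b = z≤n
bit-mono {true}  a⇒b with refl ← a⇒b refl = ≤-refl

count-mono : ∀ {n} {f g : Fin n → Bool} → f ⊆ᵇ g → count f ≤ count g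
count-mono {zero}  f⊆g = z≤n
count-mono {suc n} f⊆g = +-mono-≤ (bit-mono (f⊆g zero)) (count-mono (λ u → f⊆g (suc u)))

count-< : ∀ {n} {f g : Fin n → Bool} → f ⊆ᵇ g → ∀ v → f v ≡ false → g v ≡ true → count f < count g
count-< f⊆g zero    fv gv rewrite fv | gv = s≤s (count-mono (λ u → f⊆g (suc u)))
count-< f⊆g (suc v) fv gv = +-mono-≤-< (bit-mono (f⊆g zero)) (count-< (λ u → f⊆g (suc u)) v fv gv)

countVec : ∀ {n m} → (Fin n → Bool) → Vec (Fin n) m → ℕ
countVec s []       = 0
countVec s (x ∷ xs) = (if s x then 1 else 0) + countVec s xs

countVec-tabulate : ∀ {n} m (s : Fin n → Bool) (p : Fin m → Fin n) →
                    countVec s (tabulate p) ≡ count (λ i → s (p i))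
countVec-tabulate zero    s p = refl
countVec-tabulate (suc m) s p = cong ((if s (p zero) then 1 else 0) +_) (countVec-tabulate m s (λ i → p (suc i)))

occupy-⊇ : ∀ {n} (occ : Fin n → Bool) v → occ ⊆ᵇ occupy occ v
occupy-⊇ occ v u occ-u with u ≟ v
... | yes _ = refl
... | no  _ = occ-u

occupy-self : ∀ {n} (occ : Fin n → Bool) v → occupy occ v v ≡ true
occupy-self occ v with v ≟ v
... | yes _   = refl
... | no v≢v = contradiction refl v≢v

module _ {N : ℕ} (T : RootedTree N) where

  pathTo-suc : ∀ k u w → pathTo T k u w ≡ true → pathTo T (suc k) u w ≡ true
  pathTo-suc (suc k) u w path with u ≟ w
  ... | yes _ = refl
  ... | no  _ = pathTo-suc k (par T u) w path

  seek-unoccupied : ∀ k occ x v → seek T occ k x ≡ just v → occ v ≡ false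
  seek-unoccupied (suc k) occ x v seek≡v with occ x in occ-x
  ... | true  = seek-unoccupied k occ (par T x) v seek≡v
  seek-unoccupied (suc k) occ x .x refl | false = occ-x

  seek-below : ∀ k occ x w → pathTo T k x w ≡ true → occ w ≡ false →
               ∃ λ v → seek T occ k x ≡ just v × pathTo T k v w ≡ true
  seek-below (suc k) occ x w path occ-w with occ x in occ-x
  ... | false = x , refl , path
  ... | true with x ≟ w
  ...   | yes refl with () ← trans (sym occ-x) occ-w
  ...   | no  _ with seek-below k occ (par T x) w path occ-w
  ...     | v , seek≡v , v-path = v , seek≡v , pathTo-suc k v w v-path

  module Subtree (w : Fin N) where

    S : Fin N → Bool
    S u = inSubtree T u w

    load : (Fin N → Bool) → ℕ
    load occ = count (λ u → S u ∧ occ u)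

    load≤capacity : ∀ occ → load occ ≤ count S
    load≤capacity occ = count-mono (∧-⊆ᵇˡ S occ)

    load-occupy-mono : ∀ occ v → load occ ≤ load (occupy occ v)
    load-occupy-mono occ v = count-mono (∧-⊆ᵇʳ-mono S (occupy-⊇ occ v))

    load-occupy-< : ∀ occ v → occ v ≡ false → S v ≡ true → load occ < load (occupy occ v)
    load-occupy-< occ v occ-v v∈S = count-< (∧-⊆ᵇʳ-mono S (occupy-⊇ occ v)) v
      (trans (cong (S v ∧_) occ-v) (∧-zeroʳ (S v)))
      (trans (cong (_∧ occupy occ v v) v∈S) (occupy-self occ v))

    park-step : ∀ {occ x v} → occ w ≡ false → seek T occ N x ≡ just v →
                (if S x then 1 else 0) + load occ ≤ load (occupy occ v)
    park-step {occ} {x} {v} occ-w seek≡v with S x in x∈S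
    ... | false = load-occupy-mono occ v
    ... | true with seek-below N occ x w x∈S occ-w
    ...   | v′ , seek≡v′ , v′∈S with refl ← trans (sym seek≡v) seek≡v′ =
            load-occupy-< occ v (seek-unoccupied N occ x v seek≡v) v′∈S

    no-park-step : ∀ {occ x} → occ w ≡ false → seek T occ N x ≡ nothing → S x ≡ false
    no-park-step {occ} {x} occ-w seek≡nothing with S x in x∈S
    ... | false = refl
    ... | true with seek-below N occ x w x∈S occ-w
    ...   | _ , seek≡v , _ with () ← trans (sym seek≡nothing) seek≡v

    last-parks-at⇒demand≤capacity :
      ∀ m (xs : Vec (Fin N) (suc m)) occ → lookup (run T occ xs) (fromℕ m) ≡ just w →
      occ w ≡ false × countVec S xs + load occ ≤ count S
    last-parks-at⇒demand≤capacity zero (x ∷ []) occ last≡w with seek T occ N x in seek≡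
    last-parks-at⇒demand≤capacity zero (x ∷ []) occ refl | just .w = occ-w , (begin
        (if S x then 1 else 0) + 0 + load occ ≡⟨ cong (_+ load occ) (+-identityʳ _) ⟩
        (if S x then 1 else 0) + load occ     ≤⟨ park-step occ-w seek≡ ⟩
        load (occupy occ w)                   ≤⟨ load≤capacity (occupy occ w) ⟩
        count S                               ∎)
      where
      open ≤-Reasoning
      occ-w : occ w ≡ false
      occ-w = seek-unoccupied N occ x w seek≡
    last-parks-at⇒demand≤capacity (suc m) (x ∷ xs) occ last≡w with seek T occ N x in seek≡
    ... | nothing with last-parks-at⇒demand≤capacity m xs occ last≡w
    ...   | occ-w , fits rewrite no-park-step occ-w seek≡ = occ-w , fits
    last-parks-at⇒demand≤capacity (suc m) (x ∷ xs) occ last≡w | just v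
      with last-parks-at⇒demand≤capacity m xs (occupy occ v) last≡w
    ... | occupied-w , fits = occ-w , (begin
        bit + countVec S xs + load occ       ≡⟨ cong (_+ load occ) (+-comm bit _) ⟩
        countVec S xs + bit + load occ       ≡⟨ +-assoc (countVec S xs) bit _ ⟩
        countVec S xs + (bit + load occ)     ≤⟨ +-monoʳ-≤ (countVec S xs) (park-step occ-w seek≡) ⟩
        countVec S xs + load (occupy occ v)  ≤⟨ fits ⟩
        count S                              ∎)
      where
      open ≤-Reasoning
      bit : ℕ
      bit = if S x then 1 else 0
      occ-w : occ w ≡ false
      occ-w = ⊆ᵇ⇒false (occupy-⊇ occ v) occupied-w

proposition4p3 : (n : ℕ) (T : RootedTree (suc n)) (p : Fin (suc n) → Fin (suc n)) →
    IsPrimeParkingFunction T p → lookup (outcome T p) (fromℕ n) ≡ just (root T)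
proposition4p3 n T p (parking , prime) with parking (fromℕ n)
... | w , last≡w with w ≟ root T
...   | yes refl = last≡w
...   | no w≢root = contradiction demand≤capacity (<⇒≱ (prime w w≢root))
  where
  open Subtree T w
  open ≤-Reasoning
  demand≤capacity : count (λ i → S (p i)) ≤ count S
  demand≤capacity = begin
    count (λ i → S (p i))                        ≡⟨ sym (countVec-tabulate (suc n) S p) ⟩
    countVec S (tabulate p)                      ≤⟨ m≤m+n _ _ ⟩
    countVec S (tabulate p) + load (λ _ → false) ≤⟨ proj₂ (last-parks-at⇒demand≤capacity n (tabulate p) (λ _ → false) last≡w) ⟩
    count S                                      ∎
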